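{- Let $q$ be an even prime power and let $G$ be a decodable graph representation (over $GF(q)$) with $n$ vertices and $m$ edges. Then $u^G_{b_G}\ge b_G(n+1)+n-2m+1$.
   Context: Graph representation of a coding scheme on packets $p_1,\dots,p_n\in GF(q)^\ell$ ($n\ge2$): vertices $p_1,\dots,p_n$, an edge joining $p_j,p_k$ per encoding $p_j+p_k$ ($j\ne k$), a loop at $p_j$ per encoding $p_j$ (multigraph, edges labelled distinctly). A spanning subgraph is decodable if the encodings of its edges determine $p_1,\dots,p_n$ uniquely, otherwise undecodable. For $G=(V,E)$ and integer $x$, $c^G_x$ is the number of $x$-element subsets $X\subseteq E$ with $(V,E\setminus X)$ decodable, and $u^G_x=\binom{m}{x}-c^G_x$. $b_G$ is the smallest $|\mathcal L|$, $\mathcal L\subseteq E$, with $(V,E\setminus\mathcal L)$ undecodable. -}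

module Defs where

open import Level using (Level; _⊔_)
open import Data.Nat using (ℕ; suc; _≤_; _^_)
open import Data.Nat.Divisibility using (_∣_)
open import Data.Nat.Primality using (Prime)
open import Data.Fin using (Fin)
open import Data.Fin.Subset using (Subset; _∉_; ∣_∣)
open import Data.List using (List; length)
open import Data.List.Membership.Propositional using (_∈_)
open import Data.List.Relation.Unary.Unique.Propositional using (Unique)
open import Data.Product using (Σ; ∃; ∃₂; _×_)
open import Relation.Binary.PropositionalEquality using (_≡_; _≢_) renaming (setoid to ≡-setoid)
open import Relation.Nullary using (¬_)
open import Function.Bundles using (Inverse)
open import Algebra.Bundles using (CommutativeRing)

-- A commutative ring R is GF(q) (up to isomorphism) when it is a field
-- (1 ≉ 0, every nonzero element invertible) with exactly q elements
-- (a setoid bijection with Fin q).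

record IsGF {c ℓ : Level} (R : CommutativeRing c ℓ) (q : ℕ) : Set (c ⊔ ℓ) where
  open CommutativeRing R
  field
    nontrivial : ¬ (1# ≈ 0#)
    inverses   : ∀ x → ¬ (x ≈ 0#) → Σ Carrier λ y → x * y ≈ 1#
    card       : Inverse setoid (≡-setoid (Fin q))

EvenPrimePower : ℕ → Set
EvenPrimePower q = (∃₂ λ p k → Prime p × q ≡ p ^ k) × (2 ∣ q)

-- Graph representations: n vertices (packets), m labelled edges.
-- An edge is either a loop at p_j (encoding p_j) or an edge joining
-- p_j, p_k with j ≠ k (encoding p_j + p_k).

data Edge (n : ℕ) : Set where
  loop : Fin n → Edge n
  link : (j k : Fin n) → j ≢ k → Edge n

Graph : ℕ → ℕ → Set
Graph n m = Fin m → Edge n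

module Coding {c ℓ' : Level} (R : CommutativeRing c ℓ') (ℓ : ℕ) where
  open CommutativeRing R

  Packet : Set c
  Packet = Fin ℓ → Carrier

  _≈ᴾ_ : Packet → Packet → Set ℓ'
  x ≈ᴾ y = ∀ i → x i ≈ y i

  encode : {n : ℕ} → Edge n → (Fin n → Packet) → Packet
  encode (loop j)     p = p j
  encode (link j k _) p = λ i → p j i + p k i

  DecodableWithout : {n m : ℕ} → Graph n m → Subset m → Set (c ⊔ ℓ')
  DecodableWithout {n} {m} G X =
    (p p′ : Fin n → Packet) →
    (∀ (e : Fin m) → e ∉ X → encode (G e) p ≈ᴾ encode (G e) p′) →
    ∀ (j : Fin n) → p j ≈ᴾ p′ j

  Decodable : {n m : ℕ} → Graph n m → Set (c ⊔ ℓ')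
  Decodable {m = m} G = DecodableWithout G Data.Fin.Subset.⊥

  IsB : {n m : ℕ} → Graph n m → ℕ → Set (c ⊔ ℓ')
  IsB {m = m} G b =
    (Σ (Subset m) λ L → ∣ L ∣ ≡ b × ¬ DecodableWithout G L) ×
    (∀ (L : Subset m) → ¬ DecodableWithout G L → b ≤ ∣ L ∣)

  -- u is u^G_x: the number of x-element subsets X ⊆ E with (V, E \ X)
  -- undecodable; witnessed by a duplicate-free list enumerating exactly
  -- these subsets.
  IsU : {n m : ℕ} → Graph n m → ℕ → ℕ → Set (c ⊔ ℓ')
  IsU {m = m} G x u =
    Σ (List (Subset m)) λ Xs →
      Unique Xs × length Xs ≡ u ×
      (∀ (X : Subset m) → (X ∈ Xs → ∣ X ∣ ≡ x × ¬ DecodableWithout G X)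
                        × (∣ X ∣ ≡ x → ¬ DecodableWithout G X → X ∈ Xs))

-- An even q forces characteristic 2: otherwise negation would be an involution of GF(q)
-- fixing only 0, and q would be odd. In characteristic 2 each of the n + 1 edge sets
-- star v (the edges at v) and loops is undecodable, because the packet assignment that is 1
-- at v and 0 elsewhere, resp. 1 everywhere, has the same encodings as 0 on all remaining
-- edges. Decodability of G makes these n + 1 sets pairwise distinct. Each has size ≥ b_G, and
-- those of size exactly b_G are among the u^G_{b_G} counted sets, so
-- (n + 1)(b_G + 1) ≤ Σ |S| + u^G_{b_G} = 2m + u^G_{b_G}; the sum is 2m because every edge
-- contributes 2 to it (a link to the stars of its two ends, a loop to its star and to loops).
module Submission where

import Algebra.Bundles

module Finite where

  open import Data.Bool.Base using (Bool; true; false)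
  open import Data.Nat.Base using (ℕ; zero; suc; _+_; _*_; _≤_; s≤s)
  open import Data.Nat.Properties using (+-0-commutativeMonoid; +-identityʳ; *-identityʳ; *-zeroʳ; even≢odd)
  open import Data.Nat.Divisibility using (_∣_; quotient; m∣n⇒n≡m*quotient)
  open import Data.Nat.ListAction using () renaming (sum to sumₗ)
  open import Data.Fin.Base using (Fin; zero; suc)
  open import Data.Fin.Properties using (_≟_; _<?_; <-cmp; <-irrefl)
  open import Data.Fin.Permutation using (permutation)
  open import Data.Fin.Subset using (∣_∣; _∉_)
  open import Data.Vec.Base using (tabulate; lookup)
  open import Data.Vec.Properties using (lookup∘tabulate; lookup⇒[]=)
  open import Data.List.Base as List using ()
  open import Data.Product using (∃-syntax; _,_)
  open import Function.Base using (_∘_)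
  open import Relation.Binary.Definitions using (tri<; tri≈; tri>)
  open import Relation.Binary.PropositionalEquality
    using (_≡_; _≢_; refl; sym; trans; cong; cong₂; module ≡-Reasoning)
  open import Relation.Nullary using (¬_; yes; no; does; contradiction)
  open import Relation.Nullary.Decidable using (dec-true; dec-false)
  open import Algebra.Properties.CommutativeMonoid.Sum +-0-commutativeMonoid
    using (sum-syntax; sum-cong-≗; sum-permute; ∑-distrib-+)

  iverson : Bool → ℕ
  iverson true  = 1
  iverson false = 0

  ∑-const : ∀ n k → ∑[ i < n ] k ≡ n * k
  ∑-const zero    k = refl
  ∑-const (suc n) k = cong (k +_) (∑-const n k)

  ∑-δ : ∀ {n} (z : Fin n) → ∑[ i < n ] iverson (does (i ≟ z)) ≡ 1
  ∑-δ {suc n} zero    = cong suc (trans (∑-const n 0) (*-zeroʳ n))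
  ∑-δ {suc n} (suc z) = ∑-δ z

  ∣tabulate∣≡∑ : ∀ {n} (f : Fin n → Bool) → ∣ tabulate f ∣ ≡ ∑[ i < n ] iverson (f i)
  ∣tabulate∣≡∑ {zero}  f = refl
  ∣tabulate∣≡∑ {suc n} f with f zero
  ... | true  = cong suc (∣tabulate∣≡∑ (f ∘ suc))
  ... | false = ∣tabulate∣≡∑ (f ∘ suc)

  sum-tabulate : ∀ {n} (f : Fin n → ℕ) → sumₗ (List.tabulate f) ≡ ∑[ i < n ] f i
  sum-tabulate {zero}  f = refl
  sum-tabulate {suc n} f = cong (f zero +_) (sum-tabulate (f ∘ suc))

  -- Every i ≢ z satisfies exactly one of i < f i and f i < i, and f exchanges the two
  -- kinds, so n = 1 + 2 · ascents.
  module _ {n} (f : Fin n → Fin n) (f∘f≗id : ∀ i → f (f i) ≡ i)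
           (z : Fin n) (fz≡z : f z ≡ z) (fixed⇒≡z : ∀ i → f i ≡ i → i ≡ z) where

    private
      ascents : ℕ
      ascents = ∑[ i < n ] iverson (does (i <? f i))

      trichotomy : ∀ i → 1 ≡ iverson (does (i ≟ z)) + (iverson (does (i <? f i)) + iverson (does (f i <? i)))
      trichotomy i with i ≟ z
      ... | yes refl rewrite fz≡z | dec-false (i <? i) (<-irrefl refl) = refl
      trichotomy i | no i≢z with <-cmp i (f i)
      ... | tri< i<fi _ fi≮i rewrite dec-true (i <? f i) i<fi | dec-false (f i <? i) fi≮i = refl
      ... | tri≈ _ i≡fi _    = contradiction (fixed⇒≡z i (sym i≡fi)) i≢z
      ... | tri> i≮fi _ fi<i rewrite dec-false (i <? f i) i≮fi | dec-true (f i <? i) fi<i = refl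

      descents≡ascents : ∑[ i < n ] iverson (does (f i <? i)) ≡ ascents
      descents≡ascents = trans (sum-permute _ (permutation f f f∘f≗id f∘f≗id))
                               (sum-cong-≗ (λ i → cong (λ j → iverson (does (j <? f i))) (f∘f≗id i)))

      n≡1+2*ascents : n ≡ suc (2 * ascents)
      n≡1+2*ascents = begin
        n
          ≡⟨ trans (∑-const n 1) (*-identityʳ n) ⟨
        ∑[ i < n ] 1
          ≡⟨ sum-cong-≗ trichotomy ⟩
        ∑[ i < n ] (iverson (does (i ≟ z)) + (iverson (does (i <? f i)) + iverson (does (f i <? i))))
          ≡⟨ ∑-distrib-+ (λ i → iverson (does (i ≟ z))) _ ⟩
        ∑[ i < n ] iverson (does (i ≟ z)) + ∑[ i < n ] (iverson (does (i <? f i)) + iverson (does (f i <? i)))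
          ≡⟨ cong₂ _+_ (∑-δ z) (∑-distrib-+ (λ i → iverson (does (i <? f i))) _) ⟩
        suc (ascents + ∑[ i < n ] iverson (does (f i <? i)))
          ≡⟨ cong (λ d → suc (ascents + d)) (trans descents≡ascents (sym (+-identityʳ ascents))) ⟩
        suc (2 * ascents)
          ∎
        where open ≡-Reasoning

    involution⇒¬2∣ : ¬ 2 ∣ n
    involution⇒¬2∣ 2∣n = even≢odd (quotient 2∣n) ascents (trans (sym (m∣n⇒n≡m*quotient 2∣n)) n≡1+2*ascents)

  tabulate-injective : ∀ {a} {A : Set a} {n} {f g : Fin n → A} → tabulate f ≡ tabulate g → ∀ i → f i ≡ g i
  tabulate-injective {f = f} {g} eq i =
    trans (sym (lookup∘tabulate f i)) (trans (cong (λ xs → lookup xs i) eq) (lookup∘tabulate g i))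

  ∉-tabulate : ∀ {n} {f : Fin n → Bool} {i} → i ∉ tabulate f → f i ≡ false
  ∉-tabulate {f = f} {i} i∉ with f i in fi≡b
  ... | false = refl
  ... | true  = contradiction (lookup⇒[]= i (tabulate f) (trans (lookup∘tabulate f i) fi≡b)) i∉

  ∃-≢ : ∀ {n} → 2 ≤ n → (v : Fin n) → ∃[ w ] w ≢ v
  ∃-≢ (s≤s (s≤s _)) zero    = suc zero , λ ()
  ∃-≢ (s≤s (s≤s _)) (suc _) = zero , λ ()

module Lists {a} {A : Set a} where

  open import Data.Nat.Base using (ℕ; suc; _+_; _*_; _≤_; z≤n; s≤s)
  open import Data.Nat.Properties using (+-suc; +-assoc; +-monoʳ-≤; +-mono-≤; ≤∧≢⇒<; module ≤-Reasoning)
    renaming (_≟_ to _≟ℕ_)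
  open import Data.Nat.ListAction using () renaming (sum to sumₗ)
  open import Data.List.Base as List using (List; []; _∷_; length; filter)
  open import Data.List.Properties using (length-removeAt′; filter-accept; filter-reject)
  open import Data.List.Membership.Propositional using (_∈_; _─_)
  open import Data.List.Membership.Propositional.Properties using (∈-filter⁻)
  open import Data.List.Relation.Unary.Any using (here; there; index)
  open import Data.List.Relation.Unary.All as All using (All; []; _∷_)
  open import Data.List.Relation.Unary.Unique.Propositional using (Unique; _∷_)
  open import Data.List.Relation.Unary.Unique.Propositional.Properties using (filter⁺)
  open import Data.List.Relation.Binary.Subset.Propositional using (_⊆_)
  open import Data.Product using (_,_)
  open import Relation.Binary.PropositionalEquality using (_≡_; _≢_; refl; cong; ≢-sym)
  open import Relation.Nullary using (yes; no; contradiction)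

  ∈-─⁺ : ∀ {x y : A} {ys} (x∈ys : x ∈ ys) → y ∈ ys → y ≢ x → y ∈ ys ─ x∈ys
  ∈-─⁺ (here refl)  (here refl)  y≢x = contradiction refl y≢x
  ∈-─⁺ (here _)     (there y∈ys) _   = y∈ys
  ∈-─⁺ (there _)    (here refl)  _   = here refl
  ∈-─⁺ (there x∈ys) (there y∈ys) y≢x = there (∈-─⁺ x∈ys y∈ys y≢x)

  Unique∧⊆⇒length≤ : ∀ {xs ys : List A} → Unique xs → xs ⊆ ys → length xs ≤ length ys
  Unique∧⊆⇒length≤ {[]}          _              _     = z≤n
  Unique∧⊆⇒length≤ {x ∷ xs} {ys} (x∉xs ∷ uniq) xs⊆ys = begin
    suc (length xs)            ≤⟨ s≤s (Unique∧⊆⇒length≤ uniq xs⊆ys─x) ⟩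
    suc (length (ys ─ x∈ys))   ≡⟨ length-removeAt′ ys (index x∈ys) ⟨
    length ys                  ∎
    where
    open ≤-Reasoning
    x∈ys = xs⊆ys (here refl)
    xs⊆ys─x : xs ⊆ ys ─ x∈ys
    xs⊆ys─x y∈xs = ∈-─⁺ x∈ys (xs⊆ys (there y∈xs)) (≢-sym (All.lookup x∉xs y∈xs))

  length*suc≤sum+length-filter : ∀ (f : A → ℕ) b (xs : List A) → All (λ x → b ≤ f x) xs →
    length xs * suc b ≤ sumₗ (List.map f xs) + length (filter (λ x → f x ≟ℕ b) xs)
  length*suc≤sum+length-filter f b []       []             = z≤n
  length*suc≤sum+length-filter f b (x ∷ xs) (b≤fx ∷ b≤fxs) with f x ≟ℕ b
  ... | yes fx≡b rewrite filter-accept (λ y → f y ≟ℕ b) {xs = xs} fx≡b = begin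
    suc b + length xs * suc b   ≤⟨ +-monoʳ-≤ (suc b) ih ⟩
    suc (b + (S + C))           ≡⟨ cong suc (+-assoc b S C) ⟨
    suc (b + S + C)             ≡⟨ +-suc (b + S) C ⟨
    b + S + suc C               ≡⟨ cong (λ t → t + S + suc C) fx≡b ⟨
    f x + S + suc C             ∎
    where
    open ≤-Reasoning
    S = sumₗ (List.map f xs)
    C = length (filter (λ y → f y ≟ℕ b) xs)
    ih = length*suc≤sum+length-filter f b xs b≤fxs
  ... | no fx≢b rewrite filter-reject (λ y → f y ≟ℕ b) {xs = xs} fx≢b = begin
    suc b + length xs * suc b   ≤⟨ +-mono-≤ (≤∧≢⇒< b≤fx (≢-sym fx≢b)) ih ⟩
    f x + (S + C)               ≡⟨ +-assoc (f x) S C ⟨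
    f x + S + C                 ∎
    where
    open ≤-Reasoning
    S = sumₗ (List.map f xs)
    C = length (filter (λ y → f y ≟ℕ b) xs)
    ih = length*suc≤sum+length-filter f b xs b≤fxs

  length*suc≤sum+length : ∀ {p} (P : A → Set p) (size : A → ℕ) b → (∀ x → P x → b ≤ size x) →
    ∀ {xs ys : List A} → Unique xs → All P xs → (∀ x → size x ≡ b → P x → x ∈ ys) →
    length xs * suc b ≤ sumₗ (List.map size xs) + length ys
  length*suc≤sum+length P size b P⇒b≤size {xs} {ys} uniq Pxs ys-complete = begin
    length xs * suc b
      ≤⟨ length*suc≤sum+length-filter size b xs (All.map (P⇒b≤size _) Pxs) ⟩
    sumₗ (List.map size xs) + length size≡b
      ≤⟨ +-monoʳ-≤ _ (Unique∧⊆⇒length≤ (filter⁺ _ uniq) size≡b⊆ys) ⟩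
    sumₗ (List.map size xs) + length ys
      ∎
    where
    open ≤-Reasoning
    size≡b = filter (λ x → size x ≟ℕ b) xs
    size≡b⊆ys : size≡b ⊆ ys
    size≡b⊆ys x∈ with x∈xs , size-x≡b ← ∈-filter⁻ (λ x → size x ≟ℕ b) x∈ =
      ys-complete _ size-x≡b (All.lookup Pxs x∈xs)

module FiniteField {c ℓ} (R : Algebra.Bundles.CommutativeRing c ℓ) where

  open import Data.Nat.Divisibility using (_∣_)
  open import Data.Fin.Base using (Fin)
  open import Data.Fin.Properties using (_≟_)
  open import Data.Product using (_,_)
  import Algebra.Properties.Ring as RingProperties
  open import Function.Base using (_∘_)
  open import Function.Bundles using (Inverse)
  open import Relation.Binary.PropositionalEquality as ≡ using (_≡_)
  open import Relation.Nullary using (¬_; yes; no; contradiction)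
  open import Defs using (IsGF)
  open Finite using (involution⇒¬2∣)

  open Algebra.Bundles.CommutativeRing R
  open RingProperties ring using (-‿involutive; -0#≈0#)
  open import Relation.Binary.Reasoning.Setoid setoid

  unit*x≈0⇒x≈0 : ∀ {a a⁻¹ x} → a * a⁻¹ ≈ 1# → a * x ≈ 0# → x ≈ 0#
  unit*x≈0⇒x≈0 {a} {a⁻¹} {x} aa⁻¹≈1 ax≈0 = begin
    x               ≈⟨ *-identityˡ x ⟨
    1# * x          ≈⟨ *-congʳ (trans (sym aa⁻¹≈1) (*-comm a a⁻¹)) ⟩
    (a⁻¹ * a) * x   ≈⟨ *-assoc a⁻¹ a x ⟩
    a⁻¹ * (a * x)   ≈⟨ *-congˡ ax≈0 ⟩
    a⁻¹ * 0#        ≈⟨ zeroʳ a⁻¹ ⟩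
    0#              ∎

  x+x≈[1+1]*x : ∀ x → x + x ≈ (1# + 1#) * x
  x+x≈[1+1]*x x = sym (trans (distribʳ x 1# 1#) (+-cong (*-identityˡ x) (*-identityˡ x)))

  module _ {q} (gf : IsGF R q) where

    open IsGF gf
    open Inverse card using (to; from; to-cong; strictlyInverseˡ; strictlyInverseʳ)

    private
      to-injective : ∀ {x y} → to x ≡ to y → x ≈ y
      to-injective {x} {y} eq = begin
        x              ≈⟨ strictlyInverseʳ x ⟨
        from (to x)    ≡⟨ ≡.cong from eq ⟩
        from (to y)    ≈⟨ strictlyInverseʳ y ⟩
        y              ∎

      negate : Fin q → Fin q
      negate i = to (- from i)

      negate-involutive : ∀ i → negate (negate i) ≡ i
      negate-involutive i =
        ≡.trans (to-cong (trans (-‿cong (strictlyInverseʳ (- from i))) (-‿involutive (from i)))) (strictlyInverseˡ i)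

      negate-fixes-0 : negate (to 0#) ≡ to 0#
      negate-fixes-0 = to-cong (trans (-‿cong (strictlyInverseʳ 0#)) -0#≈0#)

      module _ (1+1≉0 : ¬ 1# + 1# ≈ 0#) where

        x+x≈0⇒x≈0 : ∀ {x} → x + x ≈ 0# → x ≈ 0#
        x+x≈0⇒x≈0 x+x≈0 with t , [1+1]t≈1 ← inverses (1# + 1#) 1+1≉0 =
          unit*x≈0⇒x≈0 [1+1]t≈1 (trans (sym (x+x≈[1+1]*x _)) x+x≈0)

        negate-fixed⇒≡0 : ∀ i → negate i ≡ i → i ≡ to 0#
        negate-fixed⇒≡0 i negate-i≡i = ≡.trans (≡.sym (strictlyInverseˡ i)) (to-cong (x+x≈0⇒x≈0 x+x≈0))
          where
          x+x≈0 : from i + from i ≈ 0#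
          x+x≈0 = begin
            from i + from i          ≡⟨ ≡.cong (λ j → from i + from j) negate-i≡i ⟨
            from i + from (negate i) ≈⟨ +-congˡ (strictlyInverseʳ (- from i)) ⟩
            from i + - from i        ≈⟨ -‿inverseʳ (from i) ⟩
            0#                       ∎

    even-order⇒1+1≈0 : 2 ∣ q → 1# + 1# ≈ 0#
    even-order⇒1+1≈0 2∣q with to (1# + 1#) ≟ to 0#
    ... | yes to[1+1]≡to0 = to-injective to[1+1]≡to0
    ... | no  to[1+1]≢to0 = contradiction 2∣q
            (involution⇒¬2∣ negate negate-involutive (to 0#) negate-fixes-0 (negate-fixed⇒≡0 (to[1+1]≢to0 ∘ to-cong)))

module Incidence where

  open import Data.Bool.Base using (Bool; true; false; _∨_)
  open import Data.Nat.Base using (suc; _+_; _*_)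
  open import Data.Nat.Properties using (+-0-commutativeMonoid; *-comm)
  open import Data.Nat.ListAction using () renaming (sum to sumₗ)
  open import Data.Fin.Base using (Fin)
  open import Data.Fin.Properties using (_≟_)
  open import Data.Fin.Subset using (Subset; ∣_∣)
  open import Data.Vec.Base using (tabulate)
  open import Data.List.Base as List using (List; _∷_)
  open import Data.List.Properties using (map-tabulate)
  open import Function.Base using (_∘_)
  open import Relation.Binary.PropositionalEquality using (_≡_; refl; trans; cong; cong₂; module ≡-Reasoning)
  open import Relation.Nullary using (yes; no; does; contradiction)
  open import Algebra.Properties.CommutativeMonoid.Sum +-0-commutativeMonoid
    using (sum-syntax; sum-cong-≗; ∑-distrib-+; ∑-comm)
  open import Defs using (Edge; loop; link; Graph)
  open Finite using (iverson; ∑-const; ∑-δ; ∣tabulate∣≡∑; sum-tabulate)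

  incident : ∀ {n} → Fin n → Edge n → Bool
  incident v (loop j)     = does (v ≟ j)
  incident v (link j k _) = does (v ≟ j) ∨ does (v ≟ k)

  isLoop : ∀ {n} → Edge n → Bool
  isLoop (loop _)     = true
  isLoop (link _ _ _) = false

  isLoop+∑-incident≡2 : ∀ {n} (E : Edge n) → iverson (isLoop E) + ∑[ v < n ] iverson (incident v E) ≡ 2
  isLoop+∑-incident≡2 (loop j)           = cong suc (∑-δ j)
  isLoop+∑-incident≡2 {n} (link j k j≢k) = begin
    ∑[ v < n ] iverson (does (v ≟ j) ∨ does (v ≟ k))                          ≡⟨ sum-cong-≗ iverson-∨ ⟩
    ∑[ v < n ] (iverson (does (v ≟ j)) + iverson (does (v ≟ k)))              ≡⟨ ∑-distrib-+ (λ v → iverson (does (v ≟ j))) _ ⟩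
    ∑[ v < n ] iverson (does (v ≟ j)) + ∑[ v < n ] iverson (does (v ≟ k))     ≡⟨ cong₂ _+_ (∑-δ j) (∑-δ k) ⟩
    2                                                                         ∎
    where
    open ≡-Reasoning
    iverson-∨ : ∀ v → iverson (does (v ≟ j) ∨ does (v ≟ k)) ≡ iverson (does (v ≟ j)) + iverson (does (v ≟ k))
    iverson-∨ v with v ≟ j | v ≟ k
    ... | yes refl | yes refl = contradiction refl j≢k
    ... | yes _    | no  _    = refl
    ... | no  _    | yes _    = refl
    ... | no  _    | no  _    = refl

  module _ {n m} (G : Graph n m) where

    star : Fin n → Subset m
    star v = tabulate (λ e → incident v (G e))

    loops : Subset m
    loops = tabulate (λ e → isLoop (G e))

    handshake : ∣ loops ∣ + ∑[ v < n ] ∣ star v ∣ ≡ 2 * m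
    handshake = begin
      ∣ loops ∣ + ∑[ v < n ] ∣ star v ∣
        ≡⟨ cong₂ _+_ (∣tabulate∣≡∑ (λ e → isLoop (G e))) (sum-cong-≗ (λ v → ∣tabulate∣≡∑ (λ e → incident v (G e)))) ⟩
      ∑[ e < m ] iverson (isLoop (G e)) + ∑[ v < n ] ∑[ e < m ] iverson (incident v (G e))
        ≡⟨ cong (∑[ e < m ] iverson (isLoop (G e)) +_) (∑-comm (λ v e → iverson (incident v (G e)))) ⟩
      ∑[ e < m ] iverson (isLoop (G e)) + ∑[ e < m ] ∑[ v < n ] iverson (incident v (G e))
        ≡⟨ ∑-distrib-+ (λ e → iverson (isLoop (G e))) _ ⟨
      ∑[ e < m ] (iverson (isLoop (G e)) + ∑[ v < n ] iverson (incident v (G e)))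
        ≡⟨ sum-cong-≗ (λ e → isLoop+∑-incident≡2 (G e)) ⟩
      ∑[ e < m ] 2
        ≡⟨ trans (∑-const m 2) (*-comm m 2) ⟩
      2 * m
        ∎
      where open ≡-Reasoning

    loops∷stars : List (Subset m)
    loops∷stars = loops ∷ List.tabulate star

    sum-∣loops∷stars∣ : sumₗ (List.map ∣_∣ loops∷stars) ≡ 2 * m
    sum-∣loops∷stars∣ = begin
      ∣ loops ∣ + sumₗ (List.map ∣_∣ (List.tabulate star))  ≡⟨ cong (λ xs → ∣ loops ∣ + sumₗ xs) (map-tabulate star ∣_∣) ⟩
      ∣ loops ∣ + sumₗ (List.tabulate (∣_∣ ∘ star))          ≡⟨ cong (∣ loops ∣ +_) (sum-tabulate (∣_∣ ∘ star)) ⟩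
      ∣ loops ∣ + ∑[ v < n ] ∣ star v ∣                      ≡⟨ handshake ⟩
      2 * m                                                  ∎
      where open ≡-Reasoning

module Undecodability {c ℓ′} (R : Algebra.Bundles.CommutativeRing c ℓ′) where

  open import Data.Bool.Base using (false; if_then_else_)
  open import Data.Fin.Base using (Fin)
  open import Data.Fin.Properties using (_≟_)
  open import Data.Fin.Subset using (Subset; _∉_)
  open import Data.Product using (∃-syntax; proj₂)
  open import Data.List.Relation.Unary.All using (All; _∷_)
  import Data.List.Relation.Unary.All.Properties as All
  open import Data.List.Relation.Unary.Unique.Propositional using (Unique; _∷_)
  import Data.List.Relation.Unary.Unique.Propositional.Properties as Unique
  open import Function.Base using (_∘_)
  open import Relation.Binary.PropositionalEquality as ≡ using (_≡_; _≢_)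
  open import Relation.Nullary using (¬_; yes; no; does; contradiction)
  open import Relation.Nullary.Decidable using (dec-true; dec-false)
  open import Defs using (Edge; loop; link; Graph; module Coding)
  open Finite using (tabulate-injective; ∉-tabulate)
  open Incidence

  open Algebra.Bundles.CommutativeRing R
  open import Relation.Binary.Reasoning.Setoid setoid

  -- The encoding of E when every packet of vertex u is the constant vector with entries a u.
  weight : ∀ {n} → (Fin n → Carrier) → Edge n → Carrier
  weight a (loop j)     = a j
  weight a (link j k _) = a j + a k

  module _ {ℓ} (i : Fin ℓ) (1≉0 : ¬ 1# ≈ 0#) where

    open Coding R ℓ

    ¬decodable-by : ∀ {n m} (G : Graph n m) {X : Subset m} (a : Fin n → Carrier) →
                    (∀ e → e ∉ X → weight a (G e) ≈ 0#) → ∀ v → a v ≈ 1# → ¬ DecodableWithout G X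
    ¬decodable-by G a weight≈0 v av≈1 D = 1≉0 (trans (sym av≈1) (sym (D zeroᴾ aᴾ agree v i)))
      where
      zeroᴾ aᴾ : Fin _ → Packet
      zeroᴾ _ _ = 0#
      aᴾ u _ = a u
      encode-zeroᴾ : ∀ E j → encode E zeroᴾ j ≈ 0#
      encode-zeroᴾ (loop _)     _ = refl
      encode-zeroᴾ (link _ _ _) _ = +-identityˡ 0#
      encode-aᴾ : ∀ E j → encode E aᴾ j ≡ weight a E
      encode-aᴾ (loop _)     _ = ≡.refl
      encode-aᴾ (link _ _ _) _ = ≡.refl
      agree : ∀ e → e ∉ _ → encode (G e) zeroᴾ ≈ᴾ encode (G e) aᴾ
      agree e e∉X j = begin
        encode (G e) zeroᴾ j   ≈⟨ encode-zeroᴾ (G e) j ⟩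
        0#                     ≈⟨ weight≈0 e e∉X ⟨
        weight a (G e)         ≡⟨ encode-aᴾ (G e) j ⟨
        encode (G e) aᴾ j      ∎

    module _ {n m} (G : Graph n m) where

      star-undecodable : ∀ v → ¬ DecodableWithout G (star G v)
      star-undecodable v = ¬decodable-by G a (λ e e∉ → weight-a (G e) (∉-tabulate e∉)) v a-v
        where
        a : Fin n → Carrier
        a u = if does (v ≟ u) then 1# else 0#
        a-v : a v ≈ 1#
        a-v = reflexive (≡.cong (if_then 1# else 0#) (dec-true (v ≟ v) ≡.refl))
        weight-a : ∀ E → incident v E ≡ false → weight a E ≈ 0#
        weight-a (loop j) with v ≟ j
        ... | yes _ = λ ()
        ... | no  _ = λ _ → refl
        weight-a (link j k _) with v ≟ j | v ≟ k
        ... | yes _ | _     = λ ()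
        ... | no  _ | yes _ = λ ()
        ... | no  _ | no  _ = λ _ → +-identityˡ 0#

      -- If star v = star w, an edge at v is an edge at w as well, so it is the link vw;
      -- the assignment 1 at v and -1 at w is then invisible on every edge.
      star-injective : Decodable G → ∀ {v w} → star G v ≡ star G w → v ≡ w
      star-injective dec {v} {w} star-v≡star-w with v ≟ w
      ... | yes v≡w = v≡w
      ... | no  v≢w = contradiction dec
              (¬decodable-by G a (λ e _ → weight-a (G e) (tabulate-injective star-v≡star-w e)) v a-v)
        where
        a : Fin n → Carrier
        a u = if does (v ≟ u) then 1# else if does (w ≟ u) then - 1# else 0#
        a-v : a v ≈ 1#
        a-v = reflexive (≡.cong (if_then 1# else (if does (w ≟ v) then - 1# else 0#)) (dec-true (v ≟ v) ≡.refl))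
        weight-a : ∀ E → incident v E ≡ incident w E → weight a E ≈ 0#
        weight-a (loop j) with v ≟ j | w ≟ j
        ... | yes ≡.refl | yes ≡.refl = contradiction ≡.refl v≢w
        ... | yes _      | no  _      = λ ()
        ... | no  _      | yes _      = λ ()
        ... | no  _      | no  _      = λ _ → refl
        weight-a (link j k j≢k) with v ≟ j | v ≟ k | w ≟ j | w ≟ k
        ... | yes ≡.refl | yes ≡.refl | _          | _          = contradiction ≡.refl j≢k
        ... | _          | _          | yes ≡.refl | yes ≡.refl = contradiction ≡.refl j≢k
        ... | yes ≡.refl | _          | yes ≡.refl | _          = contradiction ≡.refl v≢w
        ... | _          | yes ≡.refl | _          | yes ≡.refl = contradiction ≡.refl v≢w
        ... | yes _      | no  _      | no  _      | yes _      = λ _ → -‿inverseʳ 1#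
        ... | no  _      | yes _      | yes _      | no  _      = λ _ → -‿inverseˡ 1#
        ... | yes _      | no  _      | no  _      | no  _      = λ ()
        ... | no  _      | yes _      | no  _      | no  _      = λ ()
        ... | no  _      | no  _      | yes _      | _          = λ ()
        ... | no  _      | no  _      | no  _      | yes _      = λ ()
        ... | no  _      | no  _      | no  _      | no  _      = λ _ → +-identityˡ 0#

      module _ (1+1≈0 : 1# + 1# ≈ 0#) where

        loops-undecodable : Fin n → ¬ DecodableWithout G (loops G)
        loops-undecodable v = ¬decodable-by G (λ _ → 1#) (λ e e∉ → weight-1 (G e) (∉-tabulate e∉)) v refl
          where
          weight-1 : ∀ E → isLoop E ≡ false → weight (λ _ → 1#) E ≈ 0#
          weight-1 (loop _)     ()
          weight-1 (link _ _ _) _ = 1+1≈0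

        -- If loops = star v, the edges at v are exactly the loops, so the assignment
        -- 0 at v and 1 elsewhere is invisible on every edge.
        loops≢star : Decodable G → ∀ {v w} → w ≢ v → loops G ≢ star G v
        loops≢star dec {v} {w} w≢v loops≡star =
          ¬decodable-by G a (λ e _ → weight-a (G e) (tabulate-injective loops≡star e)) w a-w dec
          where
          a : Fin n → Carrier
          a u = if does (v ≟ u) then 0# else 1#
          a-w : a w ≈ 1#
          a-w = reflexive (≡.cong (if_then 0# else 1#) (dec-false (v ≟ w) (w≢v ∘ ≡.sym)))
          weight-a : ∀ E → isLoop E ≡ incident v E → weight a E ≈ 0#
          weight-a (loop j) with v ≟ j
          ... | yes _ = λ _ → refl
          ... | no  _ = λ ()
          weight-a (link j k _) with v ≟ j | v ≟ k
          ... | yes _ | _     = λ ()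
          ... | no  _ | yes _ = λ ()
          ... | no  _ | no  _ = λ _ → 1+1≈0

        loops∷stars-unique : Decodable G → (∀ v → ∃[ w ] w ≢ v) → Unique (loops∷stars G)
        loops∷stars-unique dec other =
          All.tabulate⁺ (λ v → loops≢star dec (proj₂ (other v))) ∷ Unique.tabulate⁺ (star-injective dec)

        loops∷stars-undecodable : Fin n → All (λ X → ¬ DecodableWithout G X) (loops∷stars G)
        loops∷stars-undecodable v = loops-undecodable v ∷ All.tabulate⁺ star-undecodable

module Bound where

  open import Data.Nat.Base using (suc; _+_; _*_; _≤_)
  open import Data.Nat.Divisibility using (_∣_)
  open import Data.Fin.Base using (Fin; fromℕ<)
  open import Data.Fin.Subset using (∣_∣)
  open import Data.List.Properties using (length-tabulate)
  open import Data.Product using (_,_; proj₂)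
  open import Relation.Binary.PropositionalEquality using (cong; cong₂; subst₂)
  open import Relation.Nullary using (¬_)
  open import Defs using (IsGF; Graph; module Coding)
  open Finite using (∃-≢)
  open Lists using (length*suc≤sum+length)
  open Incidence using (star; sum-∣loops∷stars∣)
  open FiniteField using (even-order⇒1+1≈0)

  module _ {c ℓ′} (R : Algebra.Bundles.CommutativeRing c ℓ′) {ℓ} (i : Fin ℓ) {q} (gf : IsGF R q) (2∣q : 2 ∣ q) where

    open Coding R ℓ
    open Undecodability R using (loops∷stars-unique; loops∷stars-undecodable)

    [n+1][b+1]≤2m+u : ∀ {n m} → 2 ≤ n → (G : Graph n m) → Decodable G →
                      ∀ {b u} → IsB G b → IsU G b u → suc n * suc b ≤ 2 * m + u
    [n+1][b+1]≤2m+u 2≤n G dec {b} (_ , b≤undecodable) (Xs , _ , length-Xs≡u , Xs-complete) =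
      subst₂ _≤_ (cong (λ k → suc k * suc b) (length-tabulate (star G)))
                 (cong₂ _+_ (sum-∣loops∷stars∣ G) length-Xs≡u)
        (length*suc≤sum+length (λ X → ¬ DecodableWithout G X) ∣_∣ b b≤undecodable
          (loops∷stars-unique i 1≉0 G 1+1≈0 dec (∃-≢ 2≤n))
          (loops∷stars-undecodable i 1≉0 G 1+1≈0 (fromℕ< 2≤n))
          (λ X ∣X∣≡b X-undecodable → proj₂ (Xs-complete X) ∣X∣≡b X-undecodable))
      where
      1≉0 = IsGF.nontrivial gf
      1+1≈0 = even-order⇒1+1≈0 R gf 2∣q

module Arithmetic where

  open import Data.Nat.Base as ℕ using (suc)
  open import Data.Nat.Properties using (+-identityʳ)
  import Data.Nat.Solver
  open import Data.Integer.Base using (+_; _+_; _-_; _≥_; _⊖_)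
  open import Data.Integer.Properties using (⊖-monoˡ-≤; +-cancelˡ-⊖; m-n≡m⊖n; pos-+; module ≤-Reasoning)
  import Data.Integer.Solver
  open import Relation.Binary.PropositionalEquality using (_≡_; refl; sym; cong; subst; module ≡-Reasoning)

  ⊖-bound : ∀ {x y z} → x ℕ.≤ y ℕ.+ z → + z ≥ x ⊖ y
  ⊖-bound {x} {y} {z} x≤y+z = begin
    x ⊖ y                   ≤⟨ ⊖-monoˡ-≤ y x≤y+z ⟩
    (y ℕ.+ z) ⊖ y           ≡⟨ cong ((y ℕ.+ z) ⊖_) (+-identityʳ y) ⟨
    (y ℕ.+ z) ⊖ (y ℕ.+ 0)   ≡⟨ +-cancelˡ-⊖ y z 0 ⟩
    + z                     ∎
    where open ≤-Reasoning

  +a++b-+c++1≡[a+b+1]⊖c : ∀ a b c → + a + + b - + c + + 1 ≡ (a ℕ.+ b ℕ.+ 1) ⊖ c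
  +a++b-+c++1≡[a+b+1]⊖c a b c = begin
    + a + + b - + c + + 1     ≡⟨ solve 3 (λ a b c → a :+ b :- c :+ con (+ 1) := a :+ b :+ con (+ 1) :- c) refl (+ a) (+ b) (+ c) ⟩
    + a + + b + + 1 - + c     ≡⟨ cong (λ t → t + + 1 - + c) (pos-+ a b) ⟨
    + (a ℕ.+ b) + + 1 - + c   ≡⟨ cong (_- + c) (pos-+ (a ℕ.+ b) 1) ⟨
    + (a ℕ.+ b ℕ.+ 1) - + c   ≡⟨ m-n≡m⊖n (a ℕ.+ b ℕ.+ 1) c ⟩
    (a ℕ.+ b ℕ.+ 1) ⊖ c       ∎
    where
    open ≡-Reasoning
    open Data.Integer.Solver.+-*-Solver

  [n+1][b+1]≡b[n+1]+n+1 : ∀ n b → suc n ℕ.* suc b ≡ b ℕ.* (n ℕ.+ 1) ℕ.+ n ℕ.+ 1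
  [n+1][b+1]≡b[n+1]+n+1 = solve 2 (λ n b → (con 1 :+ n) :* (con 1 :+ b) := b :* (n :+ con 1) :+ n :+ con 1) refl
    where open Data.Nat.Solver.+-*-Solver

  ℕ-bound⇒ℤ-bound : ∀ n b m u → suc n ℕ.* suc b ℕ.≤ 2 ℕ.* m ℕ.+ u →
                    + u ≥ + (b ℕ.* (n ℕ.+ 1)) + + n - + (2 ℕ.* m) + + 1
  ℕ-bound⇒ℤ-bound n b m u bound =
    subst (+ u ≥_) (sym (+a++b-+c++1≡[a+b+1]⊖c _ n (2 ℕ.* m)))
      (⊖-bound (subst (ℕ._≤ 2 ℕ.* m ℕ.+ u) ([n+1][b+1]≡b[n+1]+n+1 n b) bound))

open import Defs
open import Level using (Level)
open import Data.Nat using (ℕ; _≤_; _*_)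
open import Algebra.Bundles using (CommutativeRing)
open import Data.Integer using (+_; _+_; _-_; _≥_)
open import Data.Fin using (fromℕ<)
open import Data.Product using (_,_)
open Arithmetic using (ℕ-bound⇒ℤ-bound)
open Bound using ([n+1][b+1]≤2m+u)

lemma7 : {c ℓ' : Level} (R : CommutativeRing c ℓ') (q : ℕ) → EvenPrimePower q → IsGF R q →
    (ℓ : ℕ) → 1 ≤ ℓ → (n m : ℕ) → 2 ≤ n → (G : Graph n m) →
    Coding.Decodable R ℓ G →
    (b u : ℕ) → Coding.IsB R ℓ G b → Coding.IsU R ℓ G b u →
    + u ≥ + (b * (n Data.Nat.+ 1)) + + n - + (2 * m) + + 1
lemma7 R q (_ , 2∣q) gf ℓ 1≤ℓ n m 2≤n G dec b u isB isU =
  ℕ-bound⇒ℤ-bound n b m u ([n+1][b+1]≤2m+u R (fromℕ< 1≤ℓ) gf 2∣q 2≤n G dec isB isU)
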